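{- If $a,b,k\in\mathbb{N}$ satisfy $k\le\min(a,b)$, then $\mathcal{D}_k([a]\times[b])\cong\mathcal{C}(a,k)\times\mathcal{C}(b,k)$ as posets.
   Context: $\mathbb{N}$ denotes the nonnegative integers, $\mathbb{Z}_+$ the positive integers, $[n]=\{1,\dots,n\}$. A Ferrers diagram is a finite order ideal of the poset $\mathbb{Z}_+^2$ with the componentwise order (French notation). The Durfee length of a Ferrers diagram $D$ is the largest $k\in\mathbb{N}$ with $[k]\times[k]\subseteq D$. $\mathcal{D}_k([a]\times[b])$ is the poset of all Ferrers diagrams of Durfee length $k$ contained in $[a]\times[b]$, ordered by inclusion. For $k\le n$, $\mathcal{C}(n,k)$ is the set of $k$-subsets of $[n]$, each written as an increasing sequence $(x_1<\dots<x_k)$, ordered by $\mathbf{x}\le\mathbf{y}$ iff $x_i\le y_i$ for all $i$; products of posets carry the componentwise order. -}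

module Defs where

open import Data.Nat using (ℕ; zero; suc; _≤_; _<_)
open import Data.Bool using (Bool; false)
open import Data.Fin using (Fin)
import Data.Fin as Fin
open import Data.Vec using (Vec; []; _∷_; lookup)
open import Data.Product using (Σ; _×_; proj₁)
open import Data.Product.Relation.Binary.Pointwise.NonDependent using (Pointwise)
open import Relation.Binary.PropositionalEquality using (_≡_)
open import Data.Bool using (true)

-- A subset of [a] × [b] is a Boolean matrix  Vec (Vec Bool b) a :
-- row i (1 ≤ i ≤ a), column j (1 ≤ j ≤ b).  We view it as a subset of
-- ℤ₊² (coordinates are 1-indexed; index 0 and anything outside the box
-- is not a member), so containment in [a] × [b] is built in.

rowCell : ∀ {b} → Vec Bool b → ℕ → Bool
rowCell []       _             = false
rowCell (x ∷ xs) zero          = false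
rowCell (x ∷ xs) (suc zero)    = x
rowCell (x ∷ xs) (suc (suc j)) = rowCell xs (suc j)

cell : ∀ {a b} → Vec (Vec Bool b) a → ℕ → ℕ → Bool
cell []      _             _ = false
cell (r ∷ D) zero          j = false
cell (r ∷ D) (suc zero)    j = rowCell r j
cell (r ∷ D) (suc (suc i)) j = cell D (suc i) j

_∈[_] : ∀ {a b} → ℕ × ℕ → Vec (Vec Bool b) a → Set
_∈[_] (i Data.Product., j) D = cell D i j ≡ true

IsFerrers : ∀ {a b} → Vec (Vec Bool b) a → Set
IsFerrers D = ∀ i j i′ j′ → 1 ≤ i′ → 1 ≤ j′ → i′ ≤ i → j′ ≤ j →
  cell D i j ≡ true → cell D i′ j′ ≡ true

SquareIn : ∀ {a b} → ℕ → Vec (Vec Bool b) a → Set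
SquareIn m D = ∀ i j → 1 ≤ i → i ≤ m → 1 ≤ j → j ≤ m → cell D i j ≡ true

DurfeeLength : ∀ {a b} → Vec (Vec Bool b) a → ℕ → Set
DurfeeLength D k = SquareIn k D × (∀ m → SquareIn m D → m ≤ k)

𝒟 : ℕ → ℕ → ℕ → Set
𝒟 k a b = Σ (Vec (Vec Bool b) a) λ D → IsFerrers D × DurfeeLength D k

_≈𝒟_ : ∀ {k a b} → 𝒟 k a b → 𝒟 k a b → Set
D ≈𝒟 E = proj₁ D ≡ proj₁ E

_⊆𝒟_ : ∀ {k a b} → 𝒟 k a b → 𝒟 k a b → Set
D ⊆𝒟 E = ∀ i j → cell (proj₁ D) i j ≡ true → cell (proj₁ E) i j ≡ true

-- 𝒞(n,k): k-subsets of [n] as increasing sequences x₁ < … < x_k.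

StrictlyIncreasing : ∀ {k} → Vec ℕ k → Set
StrictlyIncreasing {k} x = ∀ (i j : Fin k) → i Fin.< j → lookup x i < lookup x j

InRange : ℕ → ∀ {k} → Vec ℕ k → Set
InRange n {k} x = ∀ (i : Fin k) → 1 ≤ lookup x i × lookup x i ≤ n

𝒞 : ℕ → ℕ → Set
𝒞 n k = Σ (Vec ℕ k) λ x → StrictlyIncreasing x × InRange n x

_≈𝒞_ : ∀ {n k} → 𝒞 n k → 𝒞 n k → Set
x ≈𝒞 y = proj₁ x ≡ proj₁ y

_≤𝒞_ : ∀ {n k} → 𝒞 n k → 𝒞 n k → Set
_≤𝒞_ {k = k} x y = ∀ (i : Fin k) → lookup (proj₁ x) i ≤ lookup (proj₁ y) i

_≈𝒞²_ : ∀ {a b k} → 𝒞 a k × 𝒞 b k → 𝒞 a k × 𝒞 b k → Set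
_≈𝒞²_ = Pointwise _≈𝒞_ _≈𝒞_

_≤𝒞²_ : ∀ {a b k} → 𝒞 a k × 𝒞 b k → 𝒞 a k × 𝒞 b k → Set
_≤𝒞²_ = Pointwise _≤𝒞_ _≤𝒞_

-- A Ferrers diagram of Durfee length k has no cell (i, j) with i, j > k, since such a cell
-- would put the square [k+1] × [k+1] inside it. So the diagram is the union of its first k
-- rows and its first k columns: it is determined by the row lengths ρ₁ ≥ … ≥ ρ_k and the
-- column lengths κ₁ ≥ … ≥ κ_k, which lie between k and the side of the box, and inclusion of
-- diagrams is the pointwise order on both sequences. Conversely any two such sequences glue
-- to a diagram. Finally, k ≤ ρ_k ≤ … ≤ ρ₁ ≤ b amounts to the k-subset
-- ρ_k − (k − 1) < … < ρ₂ − 1 < ρ₁ of [b], and this correspondence preserves and reflects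
-- the pointwise order.

module Submission where

open import Data.Bool using (Bool; true; false)
open import Data.Fin using (Fin; toℕ; fromℕ<)
open import Data.Fin.Properties using (toℕ<n; toℕ-fromℕ<)
open import Data.Nat
open import Data.Nat.Properties
open import Data.Product using (Σ; _×_; _,_; proj₁; proj₂; swap)
open import Data.Sum using (_⊎_; inj₁; inj₂)
import Data.Sum as ⊎
open import Data.Vec using (Vec; []; _∷_; lookup; tabulate)
open import Data.Vec.Properties using (lookup∘tabulate; tabulate∘lookup; tabulate-cong)
open import Function using (_∘_; flip; _⇔_; mk⇔; Equivalence)
open import Relation.Binary.Morphism.Structures using (IsOrderIsomorphism)
open import Relation.Binary.PropositionalEquality
open import Relation.Nullary using (Dec; yes; no; does; contradiction)
open import Relation.Nullary.Decidable using (dec-true; does-⇔; _×-dec_; _⊎-dec_)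

open import Defs

≡true-ext : ∀ {x y : Bool} → (x ≡ true → y ≡ true) → (y ≡ true → x ≡ true) → x ≡ y
≡true-ext {false} {false} _ _ = refl
≡true-ext {false} {true}  _ g = g refl
≡true-ext {true}  {false} f _ = sym (f refl)
≡true-ext {true}  {true}  _ _ = refl

does≡true⇒ : ∀ {P : Set} (P? : Dec P) → does P? ≡ true → P
does≡true⇒ (yes p) _  = p
does≡true⇒ (no _)  ()

InBox : ℕ → ℕ → (ℕ → ℕ → Bool) → Set
InBox a b c = ∀ i j → c i j ≡ true → (1 ≤ i × i ≤ a) × (1 ≤ j × j ≤ b)

rowCell-zero : ∀ {b} (r : Vec Bool b) → rowCell r 0 ≡ false
rowCell-zero []      = refl
rowCell-zero (_ ∷ _) = refl

cell-zero : ∀ {a b} (D : Vec (Vec Bool b) a) j → cell D 0 j ≡ false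
cell-zero []      _ = refl
cell-zero (_ ∷ _) _ = refl

rowCell-inRange : ∀ {b} (r : Vec Bool b) j → rowCell r j ≡ true → 1 ≤ j × j ≤ b
rowCell-inRange (x ∷ r) (suc zero)    _  = s≤s z≤n , s≤s z≤n
rowCell-inRange (x ∷ r) (suc (suc j)) eq =
  s≤s z≤n , s≤s (proj₂ (rowCell-inRange r (suc j) eq))

cell-inBox : ∀ {a b} (D : Vec (Vec Bool b) a) → InBox a b (cell D)
cell-inBox (r ∷ D) (suc zero)    j eq = (s≤s z≤n , s≤s z≤n) , rowCell-inRange r j eq
cell-inBox (r ∷ D) (suc (suc i)) j eq with cell-inBox D (suc i) j eq
... | (_ , i≤a) , j∈b = (s≤s z≤n , s≤s i≤a) , j∈b

rowCell-injective : ∀ {b} (r s : Vec Bool b) →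
                    (∀ j → rowCell r j ≡ rowCell s j) → r ≡ s
rowCell-injective []      []      _  = refl
rowCell-injective (x ∷ r) (y ∷ s) eq = cong₂ _∷_ (eq 1) (rowCell-injective r s tail-eq)
  where
  tail-eq : ∀ j → rowCell r j ≡ rowCell s j
  tail-eq zero    = trans (rowCell-zero r) (sym (rowCell-zero s))
  tail-eq (suc j) = eq (suc (suc j))

cell-injective : ∀ {a b} (D E : Vec (Vec Bool b) a) →
                 (∀ i j → cell D i j ≡ cell E i j) → D ≡ E
cell-injective []      []      _  = refl
cell-injective (r ∷ D) (s ∷ E) eq =
  cong₂ _∷_ (rowCell-injective r s (eq 1)) (cell-injective D E tail-eq)
  where
  tail-eq : ∀ i j → cell D i j ≡ cell E i j
  tail-eq zero    j = trans (cell-zero D j) (sym (cell-zero E j))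
  tail-eq (suc i) j = eq (suc (suc i)) j

rowFromCells : ∀ {b} → (ℕ → Bool) → Vec Bool b
rowFromCells {zero}  p = []
rowFromCells {suc b} p = p 1 ∷ rowFromCells (p ∘ suc)

fromCells : ∀ {a b} → (ℕ → ℕ → Bool) → Vec (Vec Bool b) a
fromCells {zero}  c = []
fromCells {suc a} c = rowFromCells (c 1) ∷ fromCells (c ∘ suc)

rowCell-rowFromCells : ∀ {b} (p : ℕ → Bool) {j} → 1 ≤ j → j ≤ b →
                       rowCell (rowFromCells {b} p) j ≡ p j
rowCell-rowFromCells {suc b} p {suc zero}    _ _         = refl
rowCell-rowFromCells {suc b} p {suc (suc j)} _ (s≤s j≤b) =
  rowCell-rowFromCells (p ∘ suc) (s≤s z≤n) j≤b

cell-fromCells-inBox : ∀ {a b} (c : ℕ → ℕ → Bool) {i j} → 1 ≤ i → i ≤ a → 1 ≤ j → j ≤ b →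
                       cell (fromCells {a} {b} c) i j ≡ c i j
cell-fromCells-inBox {suc a} c {suc zero}    _ _         1≤j j≤b =
  rowCell-rowFromCells (c 1) 1≤j j≤b
cell-fromCells-inBox {suc a} c {suc (suc i)} _ (s≤s i≤a) 1≤j j≤b =
  cell-fromCells-inBox (c ∘ suc) (s≤s z≤n) i≤a 1≤j j≤b

cell-fromCells : ∀ {a b} {c : ℕ → ℕ → Bool} → InBox a b c →
                 ∀ i j → cell (fromCells {a} {b} c) i j ≡ c i j
cell-fromCells {a} {b} {c} c-inBox i j = ≡true-ext
  (λ eq → let (1≤i , i≤a) , (1≤j , j≤b) = cell-inBox (fromCells {a} {b} c) i j eq
          in trans (sym (cell-fromCells-inBox c 1≤i i≤a 1≤j j≤b)) eq)
  (λ eq → let (1≤i , i≤a) , (1≤j , j≤b) = c-inBox i j eq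
          in trans (cell-fromCells-inBox c 1≤i i≤a 1≤j j≤b) eq)

prefixLength : (ℕ → Bool) → ℕ → ℕ
prefixLength p zero    = 0
prefixLength p (suc n) with p 1
... | true  = suc (prefixLength (p ∘ suc) n)
... | false = 0

DownClosed : (ℕ → Bool) → Set
DownClosed p = ∀ {j j′} → 1 ≤ j′ → j′ ≤ j → p j ≡ true → p j′ ≡ true

SupportedIn : ℕ → (ℕ → Bool) → Set
SupportedIn n p = ∀ j → p j ≡ true → j ≤ n

prefixLength-≤ : ∀ p n → prefixLength p n ≤ n
prefixLength-≤ p zero    = z≤n
prefixLength-≤ p (suc n) with p 1
... | true  = s≤s (prefixLength-≤ (p ∘ suc) n)
... | false = z≤n

prefixLength-mono : ∀ {p q} → (∀ j → p j ≡ true → q j ≡ true) →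
                    ∀ n → prefixLength p n ≤ prefixLength q n
prefixLength-mono         p⊆q zero    = z≤n
prefixLength-mono {p} {q} p⊆q (suc n) with p 1 in p1 | q 1 in q1
... | false | _     = z≤n
... | true  | true  = s≤s (prefixLength-mono (p⊆q ∘ suc) n)
... | true  | false = contradiction (trans (sym q1) (p⊆q 1 p1)) λ ()

prefixLength-cong : ∀ {p q} → (∀ j → p j ≡ q j) → ∀ n → prefixLength p n ≡ prefixLength q n
prefixLength-cong p≗q n = ≤-antisym
  (prefixLength-mono (λ j eq → trans (sym (p≗q j)) eq) n)
  (prefixLength-mono (λ j eq → trans (p≗q j) eq) n)

<prefixLength⇒ : ∀ p n {j} → j < prefixLength p n → p (suc j) ≡ true
<prefixLength⇒ p (suc n) {j} j<len with p 1 in p1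
<prefixLength⇒ p (suc n) {zero}  _           | true = p1
<prefixLength⇒ p (suc n) {suc j} (s≤s j<len) | true = <prefixLength⇒ (p ∘ suc) n j<len

⇒<prefixLength : ∀ {p} n → DownClosed p → SupportedIn n p →
                 ∀ {j} → p (suc j) ≡ true → j < prefixLength p n
⇒<prefixLength {p} zero    _    supp {j} eq = contradiction (supp (suc j) eq) λ ()
⇒<prefixLength {p} (suc n) down supp {j} eq with p 1 in p1
... | false = contradiction (trans (sym p1) (down (s≤s z≤n) (s≤s z≤n) eq)) λ ()
⇒<prefixLength {p} (suc n) down supp {zero}  eq | true = s≤s z≤n
⇒<prefixLength {p} (suc n) down supp {suc j} eq | true = s≤s (⇒<prefixLength n
  (λ _ j′≤j → down (s≤s z≤n) (s≤s j′≤j)) (λ j eq → ≤-pred (supp (suc j) eq)) eq)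

prefixLength-spec : ∀ {p} n → DownClosed p → SupportedIn n p →
                    ∀ j → p (suc j) ≡ true ⇔ j < prefixLength p n
prefixLength-spec n down supp j = mk⇔ (⇒<prefixLength n down supp) (<prefixLength⇒ _ n)

≤-from-< : ∀ {m n} → (∀ {j} → j < m → j < n) → m ≤ n
≤-from-< {zero}  _ = z≤n
≤-from-< {suc m} h = h ≤-refl

prefixLength-unique : ∀ {p n L} → L ≤ n → (∀ j → p (suc j) ≡ true ⇔ j < L) →
                      prefixLength p n ≡ L
prefixLength-unique {p} {n} {L} L≤n spec = ≤-antisym
  (≤-from-< λ {j} j<len → Equivalence.to (spec j) (<prefixLength⇒ p n j<len))
  (≤-from-< λ {j} j<L → ⇒<prefixLength n down supp (Equivalence.from (spec j) j<L))
  where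
  down : DownClosed p
  down {suc j} {suc j′} _ (s≤s j′≤j) eq =
    Equivalence.from (spec j′) (≤-<-trans j′≤j (Equivalence.to (spec j) eq))
  supp : SupportedIn n p
  supp zero    _  = z≤n
  supp (suc j) eq = ≤-trans (Equivalence.to (spec j) eq) L≤n

record IsDurfeeDiagram (k a b : ℕ) (c : ℕ → ℕ → Bool) : Set where
  field
    inBox      : InBox a b c
    downClosed : ∀ {i j i′ j′} → 1 ≤ i′ → 1 ≤ j′ → i′ ≤ i → j′ ≤ j →
                 c i j ≡ true → c i′ j′ ≡ true
    square     : ∀ {i j} → 1 ≤ i → i ≤ k → 1 ≤ j → j ≤ k → c i j ≡ true
    noCorner   : ∀ {i j} → k < i → k < j → c i j ≢ true

isDurfeeDiagram-transpose : ∀ {k a b c} → IsDurfeeDiagram k a b c →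
                            IsDurfeeDiagram k b a (flip c)
isDurfeeDiagram-transpose d = record
  { inBox      = λ i j eq → swap (inBox j i eq)
  ; downClosed = λ 1≤i′ 1≤j′ i′≤i j′≤j → downClosed 1≤j′ 1≤i′ j′≤j i′≤i
  ; square     = λ 1≤i i≤k 1≤j j≤k → square 1≤j j≤k 1≤i i≤k
  ; noCorner   = λ k<i k<j → noCorner k<j k<i
  }
  where open IsDurfeeDiagram d

isDurfeeDiagram-cell : ∀ {k a b} {M : Vec (Vec Bool b) a} → IsFerrers M → DurfeeLength M k →
                       IsDurfeeDiagram k a b (cell M)
isDurfeeDiagram-cell {k} {M = M} ferrers (square , maximal) = record
  { inBox      = cell-inBox M
  ; downClosed = ferrers _ _ _ _
  ; square     = square _ _
  ; noCorner   = λ k<i k<j eq → 1+n≰n (maximal (suc k) λ i′ j′ 1≤i′ i′≤1+k 1≤j′ j′≤1+k →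
      ferrers _ _ i′ j′ 1≤i′ 1≤j′ (≤-trans i′≤1+k k<i) (≤-trans j′≤1+k k<j) eq)
  }

toDiagram : ∀ {k a b c} → IsDurfeeDiagram k a b c → 𝒟 k a b
toDiagram {k} {a} {b} {c} d = fromCells c , ferrers , square′ , maximal
  where
  open IsDurfeeDiagram d
  cell≗c = cell-fromCells {a} {b} inBox

  ferrers : IsFerrers (fromCells {a} {b} c)
  ferrers i j i′ j′ 1≤i′ 1≤j′ i′≤i j′≤j eq rewrite cell≗c i j | cell≗c i′ j′ =
    downClosed 1≤i′ 1≤j′ i′≤i j′≤j eq

  square′ : SquareIn k (fromCells {a} {b} c)
  square′ i j 1≤i i≤k 1≤j j≤k rewrite cell≗c i j = square 1≤i i≤k 1≤j j≤k

  maximal : ∀ m → SquareIn m (fromCells {a} {b} c) → m ≤ k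
  maximal m m-square = ≮⇒≥ λ k<m → noCorner ≤-refl ≤-refl
    (trans (sym (cell≗c (suc k) (suc k))) (m-square _ _ (s≤s z≤n) k<m (s≤s z≤n) k<m))

-- Row and column lengths

record IsDurfeeParts (k n : ℕ) (ρ : ℕ → ℕ) : Set where
  field
    lowerBound : ∀ {r} → 1 ≤ r → r ≤ k → k ≤ ρ r
    upperBound : ∀ {r} → 1 ≤ r → r ≤ k → ρ r ≤ n
    antitone   : ∀ {r r′} → 1 ≤ r′ → r′ ≤ r → r ≤ k → ρ r ≤ ρ r′

OnFirst : ℕ → (ℕ → ℕ → Set) → (ℕ → ℕ) → (ℕ → ℕ) → Set
OnFirst k _∼_ ρ ρ′ = ∀ {r} → 1 ≤ r → r ≤ k → ρ r ∼ ρ′ r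

rowLength : ℕ → (ℕ → ℕ → Bool) → ℕ → ℕ
rowLength b c i = prefixLength (c i) b

columnLength : ℕ → (ℕ → ℕ → Bool) → ℕ → ℕ
columnLength a c = rowLength a (flip c)

rowLength-mono : ∀ {c c′} → (∀ i j → c i j ≡ true → c′ i j ≡ true) →
                 ∀ b i → rowLength b c i ≤ rowLength b c′ i
rowLength-mono c⊆c′ b i = prefixLength-mono (c⊆c′ i) b

module _ {k a b c} (d : IsDurfeeDiagram k a b c) where
  open IsDurfeeDiagram d

  rowLength-spec : ∀ i j → c i (suc j) ≡ true ⇔ j < rowLength b c i
  rowLength-spec i = prefixLength-spec b
    (λ 1≤j′ j′≤j eq → downClosed (proj₁ (proj₁ (inBox _ _ eq))) 1≤j′ ≤-refl j′≤j eq)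
    (λ j eq → proj₂ (proj₂ (inBox i j eq)))

  rowLengths-isDurfeeParts : IsDurfeeParts k b (rowLength b c)
  rowLengths-isDurfeeParts = record
    { lowerBound = lowerBound
    ; upperBound = λ {r} _ _ → prefixLength-≤ (c r) b
    ; antitone   = λ {r} 1≤r′ r′≤r _ → rowLength-mono (λ _ j eq →
        downClosed 1≤r′ (proj₁ (proj₂ (inBox r j eq))) r′≤r ≤-refl eq) b r
    }
    where
    lowerBound : ∀ {r} → 1 ≤ r → r ≤ k → k ≤ rowLength b c r
    lowerBound {r} 1≤r r≤k@(s≤s _) =
      Equivalence.to (rowLength-spec r _) (square 1≤r r≤k (s≤s z≤n) ≤-refl)

columnLengths-isDurfeeParts : ∀ {k a b c} → IsDurfeeDiagram k a b c →
                              IsDurfeeParts k a (columnLength a c)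
columnLengths-isDurfeeParts = rowLengths-isDurfeeParts ∘ isDurfeeDiagram-transpose

-- Diagrams glued from hooks

InRows : ℕ → (ℕ → ℕ) → ℕ → ℕ → Set
InRows k ρ i j = (1 ≤ i × i ≤ k) × (1 ≤ j × j ≤ ρ i)

InHooks : ℕ → (ℕ → ℕ) → (ℕ → ℕ) → ℕ → ℕ → Set
InHooks k ρ κ i j = InRows k ρ i j ⊎ InRows k κ j i

inRows? : ∀ k ρ i j → Dec (InRows k ρ i j)
inRows? k ρ i j = ((1 ≤? i) ×-dec (i ≤? k)) ×-dec ((1 ≤? j) ×-dec (j ≤? ρ i))

inHooks? : ∀ k ρ κ i j → Dec (InHooks k ρ κ i j)
inHooks? k ρ κ i j = inRows? k ρ i j ⊎-dec inRows? k κ j i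

hooks : ℕ → (ℕ → ℕ) → (ℕ → ℕ) → ℕ → ℕ → Bool
hooks k ρ κ i j = does (inHooks? k ρ κ i j)

hooks⇒ : ∀ k ρ κ {i j} → hooks k ρ κ i j ≡ true → InHooks k ρ κ i j
hooks⇒ k ρ κ = does≡true⇒ (inHooks? k ρ κ _ _)

⇒hooks : ∀ k ρ κ {i j} → InHooks k ρ κ i j → hooks k ρ κ i j ≡ true
⇒hooks k ρ κ = dec-true (inHooks? k ρ κ _ _)

hooks-transpose : ∀ k ρ κ i j → hooks k ρ κ i j ≡ hooks k κ ρ j i
hooks-transpose k ρ κ i j =
  does-⇔ (mk⇔ ⊎.swap ⊎.swap) (inHooks? k ρ κ i j) (inHooks? k κ ρ j i)

inRows-mono : ∀ {k ρ ρ′ i j} → OnFirst k _≤_ ρ ρ′ → InRows k ρ i j → InRows k ρ′ i j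
inRows-mono ρ≤ρ′ ((1≤i , i≤k) , (1≤j , j≤ρi)) =
  (1≤i , i≤k) , (1≤j , ≤-trans j≤ρi (ρ≤ρ′ 1≤i i≤k))

hooks-mono : ∀ {k ρ κ} ρ′ κ′ → OnFirst k _≤_ ρ ρ′ → OnFirst k _≤_ κ κ′ →
             ∀ {i j} → hooks k ρ κ i j ≡ true → hooks k ρ′ κ′ i j ≡ true
hooks-mono {k} {ρ} {κ} ρ′ κ′ ρ≤ρ′ κ≤κ′ {i} {j} eq =
  ⇒hooks k ρ′ κ′ (⊎.map (inRows-mono ρ≤ρ′) (inRows-mono κ≤κ′) (hooks⇒ k ρ κ {i} {j} eq))

module _ {k a b ρ κ} (k≤a : k ≤ a) (k≤b : k ≤ b)
         (ρ-parts : IsDurfeeParts k b ρ) (κ-parts : IsDurfeeParts k a κ) where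
  private
    module ρ = IsDurfeeParts ρ-parts
    module κ = IsDurfeeParts κ-parts

  hooks-isDurfeeDiagram : IsDurfeeDiagram k a b (hooks k ρ κ)
  hooks-isDurfeeDiagram = record
    { inBox      = inBox
    ; downClosed = downClosed
    ; square     = λ 1≤i i≤k 1≤j j≤k →
        ⇒hooks k ρ κ (inj₁ ((1≤i , i≤k) , (1≤j , ≤-trans j≤k (ρ.lowerBound 1≤i i≤k))))
    ; noCorner   = noCorner
    }
    where
    inBox : InBox a b (hooks k ρ κ)
    inBox i j eq with hooks⇒ k ρ κ eq
    ... | inj₁ ((1≤i , i≤k) , (1≤j , j≤ρi)) =
      (1≤i , ≤-trans i≤k k≤a) , (1≤j , ≤-trans j≤ρi (ρ.upperBound 1≤i i≤k))
    ... | inj₂ ((1≤j , j≤k) , (1≤i , i≤κj)) =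
      (1≤i , ≤-trans i≤κj (κ.upperBound 1≤j j≤k)) , (1≤j , ≤-trans j≤k k≤b)

    downClosed : ∀ {i j i′ j′} → 1 ≤ i′ → 1 ≤ j′ → i′ ≤ i → j′ ≤ j →
                 hooks k ρ κ i j ≡ true → hooks k ρ κ i′ j′ ≡ true
    downClosed 1≤i′ 1≤j′ i′≤i j′≤j eq with hooks⇒ k ρ κ eq
    ... | inj₁ ((_ , i≤k) , (_ , j≤ρi)) = ⇒hooks k ρ κ (inj₁
      ((1≤i′ , ≤-trans i′≤i i≤k) , (1≤j′ , ≤-trans (≤-trans j′≤j j≤ρi) (ρ.antitone 1≤i′ i′≤i i≤k))))
    ... | inj₂ ((_ , j≤k) , (_ , i≤κj)) = ⇒hooks k ρ κ (inj₂
      ((1≤j′ , ≤-trans j′≤j j≤k) , (1≤i′ , ≤-trans (≤-trans i′≤i i≤κj) (κ.antitone 1≤j′ j′≤j j≤k))))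

    noCorner : ∀ {i j} → k < i → k < j → hooks k ρ κ i j ≢ true
    noCorner k<i k<j eq with hooks⇒ k ρ κ eq
    ... | inj₁ ((_ , i≤k) , _) = <⇒≱ k<i i≤k
    ... | inj₂ ((_ , j≤k) , _) = <⇒≱ k<j j≤k

rowLength-hooks : ∀ {k b ρ} → IsDurfeeParts k b ρ → ∀ κ → OnFirst k _≡_ (rowLength b (hooks k ρ κ)) ρ
rowLength-hooks {k} {b} {ρ} ρ-parts κ {r} 1≤r r≤k = prefixLength-unique (upperBound 1≤r r≤k) λ j →
  mk⇔ (inRow ∘ hooks⇒ k ρ κ) (λ j<ρr → ⇒hooks k ρ κ (inj₁ ((1≤r , r≤k) , (s≤s z≤n , j<ρr))))
  where
  open IsDurfeeParts ρ-parts
  inRow : ∀ {j} → InHooks k ρ κ r (suc j) → j < ρ r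
  inRow (inj₁ (_ , (_ , j<ρr))) = j<ρr
  inRow (inj₂ ((_ , j<k) , _))  = ≤-trans j<k (lowerBound 1≤r r≤k)

columnLength-hooks : ∀ {k a κ} → IsDurfeeParts k a κ → ∀ ρ →
                     OnFirst k _≡_ (columnLength a (hooks k ρ κ)) κ
columnLength-hooks {k} {a} {κ} κ-parts ρ {r} 1≤r r≤k =
  trans (prefixLength-cong (λ i → hooks-transpose k ρ κ i r) a) (rowLength-hooks κ-parts ρ 1≤r r≤k)

decomposition : ∀ {k a b c} → IsDurfeeDiagram k a b c →
                ∀ i j → c i j ≡ hooks k (rowLength b c) (columnLength a c) i j
decomposition {k} {a} {b} {c} d i j = ≡true-ext (⇒hooks k ρ κ ∘ inHooks) (fromHooks ∘ hooks⇒ k ρ κ)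
  where
  open IsDurfeeDiagram d
  ρ = rowLength b c
  κ = columnLength a c
  row-spec    = rowLength-spec d
  column-spec = rowLength-spec (isDurfeeDiagram-transpose d)

  inHooks : c i j ≡ true → InHooks k ρ κ i j
  inHooks eq with inBox i j eq | i ≤? k | j ≤? k
  ... | (1≤i , _) , (1≤j@(s≤s _) , _) | yes i≤k | _       =
    inj₁ ((1≤i , i≤k) , (1≤j , Equivalence.to (row-spec i _) eq))
  ... | (1≤i@(s≤s _) , _) , (1≤j , _) | no _    | yes j≤k =
    inj₂ ((1≤j , j≤k) , (1≤i , Equivalence.to (column-spec j _) eq))
  ... | _                             | no i≰k  | no j≰k  =
    contradiction eq (noCorner (≰⇒> i≰k) (≰⇒> j≰k))

  fromHooks : InHooks k ρ κ i j → c i j ≡ true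
  fromHooks (inj₁ (_ , (s≤s _ , j≤ρi))) = Equivalence.from (row-spec i _) j≤ρi
  fromHooks (inj₂ (_ , (s≤s _ , i≤κj))) = Equivalence.from (column-spec j _) i≤κj

-- Durfee parts as subsets

mirror : ℕ → ℕ → ℕ
mirror k n = k ∸ suc n

mirror-< : ∀ {k n} → n < k → mirror k n < k
mirror-< {n = n} (s≤s {n = k} _) = s≤s (m∸n≤m k n)

mirror-involutive : ∀ {k n} → n < k → mirror k (mirror k n) ≡ n
mirror-involutive (s≤s n≤k) = m∸[m∸n]≡n n≤k

suc-mirror-suc : ∀ {k n} → suc n < k → suc (mirror k (suc n)) ≡ mirror k n
suc-mirror-suc (s≤s 1+n≤k) = sym (+-∸-assoc 1 1+n≤k)

m∸n≤o∸n⇒m≤o : ∀ {m n o} → n < m → m ∸ n ≤ o ∸ n → m ≤ o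
m∸n≤o∸n⇒m≤o {n = zero}              _         m≤o     = m≤o
m∸n≤o∸n⇒m≤o {suc m} {suc n} {zero}  (s≤s n<m) m∸n≤0   = contradiction m∸n≤0 (<⇒≱ (m<n⇒0<n∸m n<m))
m∸n≤o∸n⇒m≤o {suc m} {suc n} {suc o} (s≤s n<m) m∸n≤o∸n = s≤s (m∸n≤o∸n⇒m≤o n<m m∸n≤o∸n)

toSubset : ∀ k → (ℕ → ℕ) → Vec ℕ k
toSubset k ρ = tabulate λ i → ρ (suc (mirror k (toℕ i))) ∸ mirror k (toℕ i)

lookup-toSubset : ∀ {k} ρ (i : Fin k) →
                  lookup (toSubset k ρ) i ≡ ρ (suc (mirror k (toℕ i))) ∸ mirror k (toℕ i)
lookup-toSubset ρ = lookup∘tabulate _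

toSubset-𝒞 : ∀ {k n ρ} → IsDurfeeParts k n ρ → 𝒞 n k
toSubset-𝒞 {k} {n} {ρ} ρ-parts = toSubset k ρ , increasing , inRange
  where
  open IsDurfeeParts ρ-parts
  mirror<ρ : ∀ (i : Fin k) → mirror k (toℕ i) < ρ (suc (mirror k (toℕ i)))
  mirror<ρ i = let s<k = mirror-< (toℕ<n i) in ≤-trans s<k (lowerBound (s≤s z≤n) s<k)

  increasing : StrictlyIncreasing (toSubset k ρ)
  increasing i j i<j rewrite lookup-toSubset ρ i | lookup-toSubset ρ j = begin-strict
    ρ (suc s) ∸ s   <⟨ ∸-monoʳ-< s′<s (<⇒≤ (mirror<ρ i)) ⟩
    ρ (suc s) ∸ s′  ≤⟨ ∸-monoˡ-≤ s′ (antitone (s≤s z≤n) (s≤s (<⇒≤ s′<s)) (mirror-< (toℕ<n i))) ⟩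
    ρ (suc s′) ∸ s′ ∎
    where
    open ≤-Reasoning
    s  = mirror k (toℕ i)
    s′ = mirror k (toℕ j)
    s′<s : s′ < s
    s′<s = ∸-monoʳ-< (s≤s i<j) (toℕ<n j)

  inRange : InRange n (toSubset k ρ)
  inRange i rewrite lookup-toSubset ρ i = m<n⇒0<n∸m (mirror<ρ i) ,
    ≤-trans (m∸n≤m _ (mirror k (toℕ i))) (upperBound (s≤s z≤n) (mirror-< (toℕ<n i)))

toSubset-cong : ∀ {k ρ ρ′} → OnFirst k _≡_ ρ ρ′ → toSubset k ρ ≡ toSubset k ρ′
toSubset-cong {k} ρ≡ρ′ = tabulate-cong λ i →
  cong (_∸ mirror k (toℕ i)) (ρ≡ρ′ (s≤s z≤n) (mirror-< (toℕ<n i)))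

toSubset-mono : ∀ {k ρ ρ′} → OnFirst k _≤_ ρ ρ′ →
                ∀ i → lookup (toSubset k ρ) i ≤ lookup (toSubset k ρ′) i
toSubset-mono {k} {ρ} {ρ′} ρ≤ρ′ i rewrite lookup-toSubset ρ i | lookup-toSubset ρ′ i =
  ∸-monoˡ-≤ (mirror k (toℕ i)) (ρ≤ρ′ (s≤s z≤n) (mirror-< (toℕ<n i)))

toSubset-reflects : ∀ {k n ρ ρ′} → IsDurfeeParts k n ρ →
                    (∀ i → lookup (toSubset k ρ) i ≤ lookup (toSubset k ρ′) i) → OnFirst k _≤_ ρ ρ′
toSubset-reflects {k} {n} {ρ} {ρ′} ρ-parts ρ≤ρ′ {suc s} _ s<k = m∸n≤o∸n⇒m≤o s<ρs (begin
  ρ (suc s) ∸ s             ≡⟨ lookup-at ρ ⟨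
  lookup (toSubset k ρ) i   ≤⟨ ρ≤ρ′ i ⟩
  lookup (toSubset k ρ′) i  ≡⟨ lookup-at ρ′ ⟩
  ρ′ (suc s) ∸ s            ∎)
  where
  open ≤-Reasoning
  i = fromℕ< (mirror-< s<k)
  mirror-i : mirror k (toℕ i) ≡ s
  mirror-i = trans (cong (mirror k) (toℕ-fromℕ< (mirror-< s<k))) (mirror-involutive s<k)
  lookup-at : ∀ σ → lookup (toSubset k σ) i ≡ σ (suc s) ∸ s
  lookup-at σ = trans (lookup-toSubset σ i) (cong (λ t → σ (suc t) ∸ t) mirror-i)
  s<ρs : s < ρ (suc s)
  s<ρs = ≤-trans s<k (IsDurfeeParts.lowerBound ρ-parts (s≤s z≤n) s<k)

lookupℕ : ∀ {m} → Vec ℕ m → ℕ → ℕ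
lookupℕ []       _       = 0
lookupℕ (x ∷ xs) zero    = x
lookupℕ (x ∷ xs) (suc n) = lookupℕ xs n

lookupℕ-toℕ : ∀ {m} (xs : Vec ℕ m) (i : Fin m) → lookupℕ xs (toℕ i) ≡ lookup xs i
lookupℕ-toℕ (x ∷ xs) Fin.zero    = refl
lookupℕ-toℕ (x ∷ xs) (Fin.suc i) = lookupℕ-toℕ xs i

lookupℕ-increasing : ∀ {m} (xs : Vec ℕ m) → StrictlyIncreasing xs →
                     ∀ {n} → suc n < m → lookupℕ xs n < lookupℕ xs (suc n)
lookupℕ-increasing (x ∷ y ∷ xs) xs↑ {zero}  _           = xs↑ Fin.zero (Fin.suc Fin.zero) (s≤s z≤n)
lookupℕ-increasing (x ∷ xs)     xs↑ {suc n} (s≤s 2+n≤m) =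
  lookupℕ-increasing xs (λ i j i<j → xs↑ (Fin.suc i) (Fin.suc j) (s≤s i<j)) 2+n≤m

lookupℕ-inRange : ∀ {b m} (xs : Vec ℕ m) → InRange b xs →
                  ∀ {n} → n < m → 1 ≤ lookupℕ xs n × lookupℕ xs n ≤ b
lookupℕ-inRange (x ∷ xs) xs∈ {zero}  _         = xs∈ Fin.zero
lookupℕ-inRange (x ∷ xs) xs∈ {suc n} (s≤s n<m) = lookupℕ-inRange xs (xs∈ ∘ Fin.suc) n<m

toParts : ∀ k → Vec ℕ k → ℕ → ℕ
toParts k xs zero    = 0
toParts k xs (suc s) = lookupℕ xs (mirror k s) + s

antitone-from-step : ∀ {lo hi} (f : ℕ → ℕ) → (∀ {r} → lo ≤ r → suc r ≤ hi → f (suc r) ≤ f r) →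
                     ∀ {r′ r} → lo ≤ r′ → r′ ≤ r → r ≤ hi → f r ≤ f r′
antitone-from-step {lo} {hi} f step {r′} lo≤r′ r′≤r = go (≤⇒≤′ r′≤r)
  where
  go : ∀ {r} → r′ ≤′ r → r ≤ hi → f r ≤ f r′
  go ≤′-refl         _    = ≤-refl
  go (≤′-step r′≤′r) r<hi =
    ≤-trans (step (≤-trans lo≤r′ (≤′⇒≤ r′≤′r)) r<hi) (go r′≤′r (<⇒≤ r<hi))

toParts-isDurfeeParts : ∀ {k n} (xs : Vec ℕ k) → StrictlyIncreasing xs → InRange n xs →
                        IsDurfeeParts k n (toParts k xs)
toParts-isDurfeeParts {k} {n} xs xs↑ xs∈ = record
  { lowerBound = λ 1≤r r≤k → ≤-trans (last-≥ (≤-trans 1≤r r≤k)) (antitone 1≤r r≤k ≤-refl)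
  ; upperBound = λ 1≤r r≤k → ≤-trans (antitone ≤-refl 1≤r r≤k) (first-≤ (≤-trans 1≤r r≤k))
  ; antitone   = antitone
  }
  where
  step : ∀ {r} → 1 ≤ r → suc r ≤ k → toParts k xs (suc r) ≤ toParts k xs r
  step {suc s} _ 2+s≤k = begin
    lookupℕ xs m + suc s    ≡⟨ +-suc _ s ⟩
    suc (lookupℕ xs m) + s  ≤⟨ +-monoˡ-≤ s (lookupℕ-increasing xs xs↑ 1+m<k) ⟩
    lookupℕ xs (suc m) + s  ≡⟨ cong (λ t → lookupℕ xs t + s) (suc-mirror-suc 2+s≤k) ⟩
    lookupℕ xs (mirror k s) + s ∎
    where
    open ≤-Reasoning
    m = mirror k (suc s)
    1+m<k : suc m < k
    1+m<k = subst (_< k) (sym (suc-mirror-suc 2+s≤k)) (mirror-< (<⇒≤ 2+s≤k))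

  antitone : ∀ {r r′} → 1 ≤ r′ → r′ ≤ r → r ≤ k → toParts k xs r ≤ toParts k xs r′
  antitone = antitone-from-step (toParts k xs) step

  last-≥ : 1 ≤ k → k ≤ toParts k xs k
  last-≥ 1≤k@(s≤s {n = k′} _) rewrite n∸n≡0 k′ =
    +-monoˡ-≤ k′ (proj₁ (lookupℕ-inRange xs xs∈ 1≤k))

  first-≤ : 1 ≤ k → toParts k xs 1 ≤ n
  first-≤ 1≤k = ≤-trans (≤-reflexive (+-identityʳ _)) (proj₂ (lookupℕ-inRange xs xs∈ (mirror-< 1≤k)))

toSubset-toParts : ∀ {k} (xs : Vec ℕ k) → toSubset k (toParts k xs) ≡ xs
toSubset-toParts {k} xs = trans (tabulate-cong entry) (tabulate∘lookup xs)
  where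
  entry : ∀ i → toParts k xs (suc (mirror k (toℕ i))) ∸ mirror k (toℕ i) ≡ lookup xs i
  entry i = begin
    lookupℕ xs (mirror k s) + s ∸ s  ≡⟨ m+n∸n≡m _ s ⟩
    lookupℕ xs (mirror k s)          ≡⟨ cong (lookupℕ xs) (mirror-involutive (toℕ<n i)) ⟩
    lookupℕ xs (toℕ i)               ≡⟨ lookupℕ-toℕ xs i ⟩
    lookup xs i                      ∎
    where
    open ≡-Reasoning
    s = mirror k (toℕ i)

module _ {a b k : ℕ} (k≤a : k ≤ a) (k≤b : k ≤ b) where

  durfeeDiagram : (D : 𝒟 k a b) → IsDurfeeDiagram k a b (cell (proj₁ D))
  durfeeDiagram (M , ferrers , durfee) = isDurfeeDiagram-cell {M = M} ferrers durfee

  toSubsets : 𝒟 k a b → 𝒞 a k × 𝒞 b k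
  toSubsets D = toSubset-𝒞 (columnLengths-isDurfeeParts d) , toSubset-𝒞 (rowLengths-isDurfeeParts d)
    where d = durfeeDiagram D

  fromSubsets : 𝒞 a k × 𝒞 b k → 𝒟 k a b
  fromSubsets ((xs , xs↑ , xs∈) , (ys , ys↑ , ys∈)) = toDiagram (hooks-isDurfeeDiagram k≤a k≤b
    (toParts-isDurfeeParts ys ys↑ ys∈) (toParts-isDurfeeParts xs xs↑ xs∈))

  toSubsets-mono : ∀ {D E} → D ⊆𝒟 E → toSubsets D ≤𝒞² toSubsets E
  toSubsets-mono D⊆E = toSubset-mono (λ {r} _ _ → rowLength-mono (flip D⊆E) a r)
                     , toSubset-mono (λ {r} _ _ → rowLength-mono D⊆E b r)

  toSubsets-cancel : ∀ {D E} → toSubsets D ≤𝒞² toSubsets E → D ⊆𝒟 E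
  toSubsets-cancel {D} {E} (cols≤ , rows≤) i j eq = trans (decomposition (durfeeDiagram E) i j)
    (hooks-mono ρE κE (toSubset-reflects {ρ′ = ρE} (rowLengths-isDurfeeParts dD) rows≤)
                      (toSubset-reflects {ρ′ = κE} (columnLengths-isDurfeeParts dD) cols≤)
                {i} {j} (trans (sym (decomposition dD i j)) eq))
    where
    dD = durfeeDiagram D
    ρE = rowLength b (cell (proj₁ E))
    κE = columnLength a (cell (proj₁ E))

  toSubsets-injective : ∀ {D E} → toSubsets D ≈𝒞² toSubsets E → D ≈𝒟 E
  toSubsets-injective {D} {E} (cols≡ , rows≡) = cell-injective _ _ λ i j →
    ≡true-ext (toSubsets-cancel {D} {E} (≡⇒≤ cols≡ , ≡⇒≤ rows≡) i j)
              (toSubsets-cancel {E} {D} (≡⇒≤ (sym cols≡) , ≡⇒≤ (sym rows≡)) i j)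
    where
    ≡⇒≤ : ∀ {m} {xs ys : Vec ℕ m} → xs ≡ ys → ∀ i → lookup xs i ≤ lookup ys i
    ≡⇒≤ refl _ = ≤-refl

  toSubsets-fromSubsets : ∀ xy → toSubsets (fromSubsets xy) ≈𝒞² xy
  toSubsets-fromSubsets ((xs , xs↑ , xs∈) , (ys , ys↑ , ys∈)) =
    trans (toSubset-cong columns) (toSubset-toParts xs) , trans (toSubset-cong rows) (toSubset-toParts ys)
    where
    xs-parts = toParts-isDurfeeParts xs xs↑ xs∈
    ys-parts = toParts-isDurfeeParts ys ys↑ ys∈
    h = hooks k (toParts k ys) (toParts k xs)
    cell≗h = cell-fromCells {a} {b} (IsDurfeeDiagram.inBox (hooks-isDurfeeDiagram k≤a k≤b ys-parts xs-parts))

    columns : OnFirst k _≡_ (columnLength a (cell (fromCells {a} {b} h))) (toParts k xs)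
    columns {r} 1≤r r≤k =
      trans (prefixLength-cong (λ i → cell≗h i r) a) (columnLength-hooks xs-parts (toParts k ys) 1≤r r≤k)

    rows : OnFirst k _≡_ (rowLength b (cell (fromCells {a} {b} h))) (toParts k ys)
    rows {r} 1≤r r≤k =
      trans (prefixLength-cong (cell≗h r) b) (rowLength-hooks ys-parts (toParts k xs) 1≤r r≤k)

  toSubsets-isOrderIsomorphism : IsOrderIsomorphism _≈𝒟_ _≈𝒞²_ _⊆𝒟_ _≤𝒞²_ toSubsets
  toSubsets-isOrderIsomorphism = record
    { isOrderMonomorphism = record
      { isOrderHomomorphism = record
        { cong = λ { {_ , _} {_ , _} refl → refl , refl }
        ; mono = λ {D} {E} → toSubsets-mono {D} {E}
        }
      ; injective = λ {D} {E} → toSubsets-injective {D} {E}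
      ; cancel    = λ {D} {E} → toSubsets-cancel {D} {E}
      }
    ; surjective = λ xy → fromSubsets xy , λ { {_ , _} refl → toSubsets-fromSubsets xy }
    }

proposition1p12 : (a b k : ℕ) → k ≤ a ⊓ b →
    Σ (𝒟 k a b → 𝒞 a k × 𝒞 b k) λ f →
      IsOrderIsomorphism _≈𝒟_ _≈𝒞²_ _⊆𝒟_ _≤𝒞²_ f
proposition1p12 a b k k≤a⊓b = toSubsets k≤a k≤b , toSubsets-isOrderIsomorphism k≤a k≤b
  where
  k≤a = ≤-trans k≤a⊓b (m⊓n≤m a b)
  k≤b = ≤-trans k≤a⊓b (m⊓n≤n a b)
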